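{- Let $G$ be a minimal counterexample to the odd Hadwiger's conjecture for the case $t$. Then the minimum degree of $G$ is at least $t$. In addition, if $d(v)=(t-2)+l$ for some vertex $v\in V(G)$, then there is no set $N'\subseteq N(v)$ of at least $l+1$ vertices that is independent.
   Context: A graph $H$ contains an odd $K_t$-minor if there are $t$ vertex-disjoint trees in $H$ such that every two are joined by an edge of $H$, and the vertices of the trees can be 2-colored so that edges inside trees are bichromatic and the chosen edges between trees are monochromatic. An odd-minor-operation consists of deleting vertices and edges, then choosing an edge cut $R$ and contracting all edges of $R$; odd minors are graphs obtained by sequences of such operations. A minimal counterexample to the odd Hadwiger's conjecture for the case $t$ is a graph $G$ such that (1) $G$ has chromatic number $t$, (2) $G$ is minimal with respect to the odd-minor relation in the class of all graphs of chromatic number $t$ (no proper odd minor of $G$ has chromatic number $t$), and (3) $G$ does not contain an odd $K_t$-minor. -}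

module Defs where

open import Data.Nat using (ℕ; _≤_)
open import Data.Bool using (Bool; true; false)
open import Data.Fin using (Fin)
open import Data.Fin.Subset using (Subset; _∈_; _⊆_; ∣_∣)
open import Data.Vec using (tabulate)
open import Data.Maybe using (Maybe; just; nothing)
open import Data.Product using (Σ; ∃; ∃-syntax; _×_; _,_)
open import Data.Empty using (⊥)
open import Relation.Nullary using (¬_)
open import Relation.Binary.PropositionalEquality using (_≡_; _≢_)
open import Relation.Binary.Construct.Closure.ReflexiveTransitive using (Star)

record Graph : Set where
  field
    n      : ℕ
    adj    : Fin n → Fin n → Bool
    sym    : ∀ u v → adj u v ≡ adj v u
    irrefl : ∀ v → adj v v ≡ false
open Graph public

Edge : (G : Graph) → Fin (n G) → Fin (n G) → Set
Edge G u v = adj G u v ≡ true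

Reach : {m : ℕ} → (Fin m → Fin m → Set) → Fin m → Fin m → Set
Reach R = Star R

N : (G : Graph) → Fin (n G) → Subset (n G)
N G v = tabulate (adj G v)

deg : (G : Graph) → Fin (n G) → ℕ
deg G v = ∣ N G v ∣

Independent : (G : Graph) → Subset (n G) → Set
Independent G S = ∀ u w → u ∈ S → w ∈ S → ¬ Edge G u w

Colorable : Graph → ℕ → Set
Colorable G k = Σ (Fin (n G) → Fin k) λ c → ∀ u v → Edge G u v → c u ≢ c v

HasChromaticNumber : Graph → ℕ → Set
HasChromaticNumber G t = Colorable G t × (∀ k → Colorable G k → t ≤ k)

Iso : Graph → Graph → Set
Iso G H =
  Σ (Fin (n G) → Fin (n H)) λ f →
  Σ (Fin (n H) → Fin (n G)) λ g →
    (∀ x → g (f x) ≡ x) × (∀ y → f (g y) ≡ y) ×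
    (∀ u v → adj H (f u) (f v) ≡ adj G u v)

-- One odd-minor-operation: delete vertices and edges (giving a subgraph S
-- with vertex set {u | keep u ≡ true} and edge set Es), choose an edge cut
-- R = δ_S(X) of S, and contract all edges of R.  The result H is described
-- up to isomorphism by the quotient map φ : V(S) → V(H), whose fibres are
-- exactly the components of (V(S), R); H has an edge between two distinct
-- classes iff S has an edge between them (loops / parallel edges dropped).

OddMinorStep : Graph → Graph → Set
OddMinorStep G H =
  Σ (Fin (n G) → Bool) λ keep →
  Σ (Fin (n G) → Fin (n G) → Bool) λ Es? →
  let Es : Fin (n G) → Fin (n G) → Set
      Es u v = Es? u v ≡ true
  in
    (∀ u v → Es u v → Edge G u v × keep u ≡ true × keep v ≡ true) ×
    (∀ u v → Es u v → Es v u) ×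
  Σ (Fin (n G) → Bool) λ X →
  let R : Fin (n G) → Fin (n G) → Set
      R u v = Es u v × X u ≢ X v
  in
  Σ (Fin (n G) → Fin (n H)) λ φ →
    (∀ a → ∃ λ u → keep u ≡ true × φ u ≡ a) ×
    (∀ u v → keep u ≡ true → keep v ≡ true →
       (φ u ≡ φ v → Reach R u v) × (Reach R u v → φ u ≡ φ v)) ×
    (∀ a b → (Edge H a b → ∃ λ u → ∃ λ v → Es u v × φ u ≡ a × φ v ≡ b × a ≢ b)
           × ((∃ λ u → ∃ λ v → Es u v × φ u ≡ a × φ v ≡ b × a ≢ b) → Edge H a b))

OddMinor : Graph → Graph → Set
OddMinor G H = Star OddMinorStep G H

ProperOddMinor : Graph → Graph → Set
ProperOddMinor G H = OddMinor G H × ¬ Iso G H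

-- Odd K_t minor: vertex-disjoint trees T_1..T_t (vertex sets given by
-- b u ≡ just i, edge sets by F), pairwise joined by an edge of G, with a
-- 2-colouring col such that tree edges are bichromatic and the chosen
-- edges between trees are monochromatic.  A tree is a nonempty connected
-- graph in which every edge is a bridge (minimally connected).

RemoveEdge : {m : ℕ} → (Fin m → Fin m → Set) → Fin m → Fin m → Fin m → Fin m → Set
RemoveEdge F u v x y = F x y × ¬ ((x ≡ u × y ≡ v) Data.Sum.⊎ (x ≡ v × y ≡ u))
  where import Data.Sum

HasOddKMinor : Graph → ℕ → Set
HasOddKMinor G t =
  Σ (Fin (n G) → Maybe (Fin t)) λ b →
  Σ (Fin (n G) → Fin (n G) → Bool) λ F? →
  Σ (Fin (n G) → Bool) λ col →
  let F : Fin (n G) → Fin (n G) → Set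
      F u v = F? u v ≡ true
  in
    (∀ u v → F u v → Edge G u v × F v u × b u ≡ b v × b u ≢ nothing × col u ≢ col v) ×
    (∀ i → ∃ λ u → b u ≡ just i) ×
    (∀ i u v → b u ≡ just i → b v ≡ just i → Reach F u v) ×
    (∀ u v → F u v → ¬ Reach (RemoveEdge F u v) u v) ×
    (∀ i j → i ≢ j → ∃ λ u → ∃ λ v →
       b u ≡ just i × b v ≡ just j × Edge G u v × col u ≡ col v)

MinimalCounterexample : ℕ → Graph → Set
MinimalCounterexample t G =
  HasChromaticNumber G t ×
  (∀ H → ProperOddMinor G H → ¬ HasChromaticNumber H t) ×
  ¬ HasOddKMinor G t

module Submission where

-- A reduction of G is a single odd-minor-operation onto a graph H with fewer
-- vertices whose colourings with at most t′ colours lift to t′-colourings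
-- of G.  None exists (`irreducible`): H would need t colours, and deleting
-- vertices one by one (each costs at most one colour) gives a proper odd
-- minor of G of chromatic number exactly t.  The instances are vertex deletion (for degree
-- < t − 1) and contraction of v with an independent N′ ⊆ N(v), after which v
-- is recoloured avoiding the < t′ classes on N(v) (refuting large N′, and
-- degree t − 1 with two non-adjacent neighbours); if instead N(v) is a
-- clique of size t − 1, then {v} ∪ N(v) is an odd K_t-minor.

open import Defs
open import Data.Nat using (ℕ; zero; suc; _≤_; _<_; _+_; z≤n; s≤s; s≤s⁻¹; _≤?_)
open import Data.Nat.Properties
  using (≤-refl; ≤-trans; <-≤-trans; <⇒≱; ≰⇒>; 1+n≰n; n≮0; +-suc; +-monoʳ-≤; +-mono-≤;
         n≤1+n; m≤n+m; +-cancelʳ-≤; m≤n⇒m<n∨m≡n; module ≤-Reasoning)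
open import Data.Nat.Tactic.RingSolver using (solve-∀)
open import Data.Bool using (Bool; true; false)
open import Data.Bool.Properties using () renaming (_≟_ to _≟ᵇ_)
open import Data.Maybe using (Maybe; just; nothing)
open import Data.Fin using (Fin; zero; suc; _≟_; inject₁; inject≤; fromℕ)
open import Data.Fin.Properties
  using (any?; ¬∀⟶∃¬; suc-injective; injective⇒≤; inject₁-injective; inject≤-injective; fromℕ≢inject₁)
open import Data.Fin.Subset using (Subset; _∈_; _∉_; _⊆_; ∣_∣; _∪_; _∩_; _─_; _-_; ⁅_⁆; ⊤) renaming (⊥ to ∅)
open import Data.Fin.Subset.Properties
  using (_∈?_; nonempty?; Empty-unique; ∣⊥∣≡0; ∣⊤∣≡n; ∣⁅x⁆∣≡1; p⊆q⇒∣p∣≤∣q∣; x∈p∪q⁺; x∈p∪q⁻;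
         x∈⁅x⁆; x∈⁅y⁆⇒x≡y; x∈p∩q⁺; x∈p∧x∉q⇒x∈p─q; x∈p∧x≢y⇒x∈p-y; x∈p⇒∣p-x∣<∣p∣)
open import Data.Vec using (_∷_; []; here; there; tabulate)
open import Data.Vec.Properties using ([]=⇒lookup; lookup⇒[]=; lookup∘tabulate)
open import Data.Product using (Σ; ∃; ∃₂; _×_; _,_; proj₁; proj₂)
open import Data.Sum using (_⊎_; inj₁; inj₂)
open import Data.Empty using (⊥) renaming (⊥-elim to absurd)
open import Function using (_∘_)
open import Function.Bundles using (mk⇔)
open import Relation.Nullary using (¬_; Dec; yes; no; ¬?; does; _×-dec_; _→-dec_)
open import Relation.Nullary.Decidable using (dec-true; dec-false; does-⇔)
open import Relation.Nullary.Decidable.Core using (¬¬-excluded-middle)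
open import Relation.Binary.PropositionalEquality
  using (_≡_; _≢_; refl; trans; cong; subst) renaming (sym to ≡sym)
open import Relation.Binary.Construct.Closure.ReflexiveTransitive using (ε; _◅_)

from-does : ∀ {P : Set} (d : Dec P) → does d ≡ true → P
from-does (yes p) _ = p
from-does (no _) ()

∣p∪q∣≤∣p∣+∣q∣ : ∀ {m} (p q : Subset m) → ∣ p ∪ q ∣ ≤ ∣ p ∣ + ∣ q ∣
∣p∪q∣≤∣p∣+∣q∣ [] [] = z≤n
∣p∪q∣≤∣p∣+∣q∣ (true ∷ p) (true ∷ q) =
  s≤s (≤-trans (∣p∪q∣≤∣p∣+∣q∣ p q) (+-monoʳ-≤ ∣ p ∣ (n≤1+n ∣ q ∣)))
∣p∪q∣≤∣p∣+∣q∣ (true ∷ p) (false ∷ q) = s≤s (∣p∪q∣≤∣p∣+∣q∣ p q)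
∣p∪q∣≤∣p∣+∣q∣ (false ∷ p) (true ∷ q) rewrite +-suc ∣ p ∣ ∣ q ∣ = s≤s (∣p∪q∣≤∣p∣+∣q∣ p q)
∣p∪q∣≤∣p∣+∣q∣ (false ∷ p) (false ∷ q) = ∣p∪q∣≤∣p∣+∣q∣ p q

∣p─q∣+∣p∩q∣≡∣p∣ : ∀ {m} (p q : Subset m) → ∣ p ─ q ∣ + ∣ p ∩ q ∣ ≡ ∣ p ∣
∣p─q∣+∣p∩q∣≡∣p∣ [] [] = refl
∣p─q∣+∣p∩q∣≡∣p∣ (true ∷ p) (true ∷ q) =
  trans (+-suc ∣ p ─ q ∣ ∣ p ∩ q ∣) (cong suc (∣p─q∣+∣p∩q∣≡∣p∣ p q))
∣p─q∣+∣p∩q∣≡∣p∣ (true ∷ p) (false ∷ q) = cong suc (∣p─q∣+∣p∩q∣≡∣p∣ p q)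
∣p─q∣+∣p∩q∣≡∣p∣ (false ∷ p) (true ∷ q) = ∣p─q∣+∣p∩q∣≡∣p∣ p q
∣p─q∣+∣p∩q∣≡∣p∣ (false ∷ p) (false ∷ q) = ∣p─q∣+∣p∩q∣≡∣p∣ p q

image-bound : ∀ {m k} (A : Subset m) (f : Fin m → Fin k) →
  Σ (Subset k) λ I → ∣ I ∣ ≤ ∣ A ∣ × (∀ u → u ∈ A → f u ∈ I)
image-bound {k = k} [] f = ∅ , subst (_≤ 0) (≡sym (∣⊥∣≡0 k)) z≤n , λ _ ()
image-bound (false ∷ A) f with image-bound A (f ∘ suc)
... | I , ∣I∣≤∣A∣ , covers = I , ∣I∣≤∣A∣ , λ { (suc u) (there u∈A) → covers u u∈A }
image-bound (true ∷ A) f with image-bound A (f ∘ suc)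
... | I , ∣I∣≤∣A∣ , covers = ⁅ f zero ⁆ ∪ I , size , covers′
  where
  size : ∣ ⁅ f zero ⁆ ∪ I ∣ ≤ suc ∣ A ∣
  size = ≤-trans (∣p∪q∣≤∣p∣+∣q∣ ⁅ f zero ⁆ I)
                 (subst (λ s → s + ∣ I ∣ ≤ suc ∣ A ∣) (≡sym (∣⁅x⁆∣≡1 (f zero))) (s≤s ∣I∣≤∣A∣))
  covers′ : ∀ u → u ∈ true ∷ A → f u ∈ ⁅ f zero ⁆ ∪ I
  covers′ zero here = x∈p∪q⁺ (inj₁ (x∈⁅x⁆ (f zero)))
  covers′ (suc u) (there u∈A) = x∈p∪q⁺ (inj₂ (covers u u∈A))

free-colour : ∀ {m k} (A : Subset m) (f : Fin m → Fin k) → ∣ A ∣ < k →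
  ∃ λ c → ∀ u → u ∈ A → f u ≢ c
free-colour {k = k} A f ∣A∣<k with image-bound A f
... | I , ∣I∣≤∣A∣ , covers with ¬∀⟶∃¬ k (_∈ I) (_∈? I) all-used
  where
  all-used : ¬ (∀ c → c ∈ I)
  all-used all∈I = <⇒≱ ∣A∣<k (≤-trans k≤∣I∣ ∣I∣≤∣A∣)
    where
    k≤∣I∣ : k ≤ ∣ I ∣
    k≤∣I∣ = subst (_≤ ∣ I ∣) (∣⊤∣≡n k) (p⊆q⇒∣p∣≤∣q∣ ⊤⊆I)
      where
      ⊤⊆I : ⊤ ⊆ I
      ⊤⊆I {c} _ = all∈I c
... | c , c∉I = c , λ u u∈A fu≡c → c∉I (subst (_∈ I) fu≡c (covers u u∈A))

members : ∀ {m} (p : Subset m) → Fin ∣ p ∣ → Fin m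
members (true ∷ p) zero = zero
members (true ∷ p) (suc i) = suc (members p i)
members (false ∷ p) i = suc (members p i)

members-∈ : ∀ {m} (p : Subset m) i → members p i ∈ p
members-∈ (true ∷ p) zero = here
members-∈ (true ∷ p) (suc i) = there (members-∈ p i)
members-∈ (false ∷ p) i = there (members-∈ p i)

members-injective : ∀ {m} (p : Subset m) {i j} → members p i ≡ members p j → i ≡ j
members-injective (true ∷ p) {zero} {zero} _ = refl
members-injective (true ∷ p) {suc i} {suc j} e = cong suc (members-injective p (suc-injective e))
members-injective (false ∷ p) e = members-injective p (suc-injective e)

record Image {a k : ℕ} (f : Fin a → Fin k) : Set where
  field
    size            : ℕ
    onto            : Fin a → Fin size
    embed           : Fin size → Fin k
    embed-injective : ∀ i j → embed i ≡ embed j → i ≡ j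
    factors         : ∀ x → embed (onto x) ≡ f x
    onto-surjective : ∀ i → ∃ λ x → onto x ≡ i

image-cons : ∀ {a k} (f : Fin (suc a) → Fin k) → Image (f ∘ suc) → Image f
image-cons f F with any? (λ i → Image.embed F i ≟ f zero)
... | yes (i , embed-i≡f0) =
  record { size = size ; onto = onto′ ; embed = embed ; embed-injective = embed-injective
         ; factors = factors′ ; onto-surjective = surjective′ }
  where
  open Image F
  onto′ : Fin _ → Fin size
  onto′ zero = i
  onto′ (suc x) = onto x
  factors′ : ∀ x → embed (onto′ x) ≡ f x
  factors′ zero = embed-i≡f0
  factors′ (suc x) = factors x
  surjective′ : ∀ j → ∃ λ x → onto′ x ≡ j
  surjective′ j = suc (proj₁ (onto-surjective j)) , proj₂ (onto-surjective j)
... | no f0-new =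
  record { size = suc size ; onto = onto′ ; embed = embed′ ; embed-injective = injective′
         ; factors = factors′ ; onto-surjective = surjective′ }
  where
  open Image F
  onto′ : Fin _ → Fin (suc size)
  onto′ zero = zero
  onto′ (suc x) = suc (onto x)
  embed′ : Fin (suc size) → Fin _
  embed′ zero = f zero
  embed′ (suc i) = embed i
  injective′ : ∀ i j → embed′ i ≡ embed′ j → i ≡ j
  injective′ zero zero _ = refl
  injective′ zero (suc j) e = absurd (f0-new (j , ≡sym e))
  injective′ (suc i) zero e = absurd (f0-new (i , e))
  injective′ (suc i) (suc j) e = cong suc (embed-injective i j e)
  factors′ : ∀ x → embed′ (onto′ x) ≡ f x
  factors′ zero = refl
  factors′ (suc x) = factors x
  surjective′ : ∀ j → ∃ λ x → onto′ x ≡ j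
  surjective′ zero = zero , refl
  surjective′ (suc j) = suc (proj₁ (onto-surjective j)) , cong suc (proj₂ (onto-surjective j))

image : ∀ {a k} (f : Fin a → Fin k) → Image f
image {zero} f = record { size = 0 ; onto = λ () ; embed = λ () ; embed-injective = λ ()
                        ; factors = λ () ; onto-surjective = λ () }
image {suc a} f = image-cons f (image (f ∘ suc))

no-loop : (G : Graph) {u w : Fin (n G)} → Edge G u w → u ≢ w
no-loop G {u} e refl with () ← trans (≡sym e) (irrefl G u)

edge-sym : (G : Graph) {u w : Fin (n G)} → Edge G u w → Edge G w u
edge-sym G {u} {w} e = trans (Graph.sym G w u) e

edge⇒∈N : (G : Graph) {v y : Fin (n G)} → Edge G v y → y ∈ N G v
edge⇒∈N G {v} {y} e = lookup⇒[]= y (tabulate (adj G v)) (trans (lookup∘tabulate (adj G v) y) e)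

∈N⇒edge : (G : Graph) {v y : Fin (n G)} → y ∈ N G v → Edge G v y
∈N⇒edge G {v} {y} y∈N = trans (≡sym (lookup∘tabulate (adj G v) y)) ([]=⇒lookup y∈N)

weaken : ∀ {K : Graph} {k k′} → k ≤ k′ → Colorable K k → Colorable K k′
weaken k≤k′ (c , proper) =
  (λ x → inject≤ (c x) k≤k′) , λ u w e eq → proper u w e (inject≤-injective k≤k′ k≤k′ _ _ eq)

two-vertices : (K : Graph) → ¬ Colorable K 1 → ∃₂ λ (x₀ x₁ : Fin (n K)) → x₀ ≢ x₁
two-vertices K not-1 with any? (λ x₀ → any? (λ x₁ → ¬? (x₀ ≟ x₁)))
... | yes (x₀ , x₁ , x₀≢x₁) = x₀ , x₁ , x₀≢x₁
... | no all-equal = absurd (not-1 ((λ _ → zero) , λ u w e _ → all-equal (u , w , no-loop K e)))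

fewer-vertices⇒¬Iso : {G H : Graph} → n H < n G → ¬ Iso G H
fewer-vertices⇒¬Iso {G} {H} nH<nG (f , g , gf , _ , _) = <⇒≱ nH<nG (injective⇒≤ f-injective)
  where
  f-injective : ∀ {x y} → f x ≡ f y → x ≡ y
  f-injective {x} {y} e = trans (≡sym (gf x)) (trans (cong g e) (gf y))

CutEdge : ∀ {m} → (Fin m → Fin m → Bool) → (Fin m → Bool) → Fin m → Fin m → Set
CutEdge Es? X u w = Es? u w ≡ true × X u ≢ X w

-- Data of an odd-minor-operation on G: kept vertices and edges, the side X
-- of the contracted cut, and a kept representative for every vertex such
-- that two kept vertices share a representative exactly when they are
-- joined by cut edges.  `missed` is a vertex that represents nothing, so
-- the quotient is strictly smaller.
record Contraction (G : Graph) : Set where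
  field
    keep           : Fin (n G) → Bool
    Es?            : Fin (n G) → Fin (n G) → Bool
    Es-edge        : ∀ u w → Es? u w ≡ true → Edge G u w × keep u ≡ true × keep w ≡ true
    Es-sym         : ∀ u w → Es? u w ≡ true → Es? w u ≡ true
    X              : Fin (n G) → Bool
    rep            : Fin (n G) → Fin (n G)
    rep-kept       : ∀ x → keep (rep x) ≡ true
    rep-idem       : ∀ x → rep (rep x) ≡ rep x
    rep-connected  : ∀ u w → keep u ≡ true → keep w ≡ true →
                     rep u ≡ rep w → Reach (CutEdge Es? X) u w
    rep-invariant  : ∀ u w → Reach (CutEdge Es? X) u w → rep u ≡ rep w
    missed         : Fin (n G)
    missed-not-rep : ∀ x → rep x ≢ missed

module Quotient {G : Graph} (C : Contraction G) where
  open Contraction C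
  private
    module I = Image (image rep)
    open I using (factors; onto-surjective)

  -- The vertices of the quotient are the classes, i.e. the values of rep;
  -- φ sends a vertex to its class and ι a class to its representative.
  classes : ℕ
  classes = I.size

  φ : Fin (n G) → Fin classes
  φ = I.onto

  ι : Fin classes → Fin (n G)
  ι = I.embed

  ι-injective : ∀ i j → ι i ≡ ι j → i ≡ j
  ι-injective = I.embed-injective

  Es : Fin (n G) → Fin (n G) → Set
  Es u w = Es? u w ≡ true

  Joined : Fin (n G) → Fin (n G) → Set
  Joined r s = ∃ λ u → ∃ λ w → rep u ≡ r × rep w ≡ s × Es u w

  joined? : ∀ r s → Dec (Joined r s)
  joined? r s = any? λ u → any? λ w → (rep u ≟ r) ×-dec (rep w ≟ s) ×-dec (Es? u w ≟ᵇ true)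

  QuotientEdge : Fin classes → Fin classes → Set
  QuotientEdge a b = a ≢ b × Joined (ι a) (ι b)

  quotient-edge? : ∀ a b → Dec (QuotientEdge a b)
  quotient-edge? a b = ¬? (a ≟ b) ×-dec joined? (ι a) (ι b)

  quotient-edge-sym : ∀ {a b} → QuotientEdge a b → QuotientEdge b a
  quotient-edge-sym (a≢b , u , w , ru , rw , uw) = a≢b ∘ ≡sym , w , u , rw , ru , Es-sym u w uw

  H : Graph
  H = record
    { n = classes
    ; adj = λ a b → does (quotient-edge? a b)
    ; sym = λ a b → does-⇔ (mk⇔ quotient-edge-sym quotient-edge-sym) (quotient-edge? a b) (quotient-edge? b a)
    ; irrefl = λ a → dec-false (quotient-edge? a a) (λ (a≢a , _) → a≢a refl)
    }

  φ-≡ : ∀ {u w} → rep u ≡ rep w → φ u ≡ φ w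
  φ-≡ {u} {w} e = ι-injective _ _ (trans (factors u) (trans e (≡sym (factors w))))

  ≡-φ : ∀ {u w} → φ u ≡ φ w → rep u ≡ rep w
  ≡-φ {u} {w} e = trans (≡sym (factors u)) (trans (cong ι e) (factors w))

  edge-transfer : ∀ u w → Es u w → rep u ≢ rep w → Edge H (φ u) (φ w)
  edge-transfer u w uw ru≢rw =
    dec-true (quotient-edge? (φ u) (φ w)) (ru≢rw ∘ ≡-φ , u , w , ≡sym (factors u) , ≡sym (factors w) , uw)

  step : OddMinorStep G H
  step = keep , Es? , Es-edge , Es-sym , X , φ , covered , fibres , edges
    where
    covered : ∀ a → ∃ λ u → keep u ≡ true × φ u ≡ a
    covered a with onto-surjective a
    ... | x , φx≡a = rep x , rep-kept x , trans (φ-≡ (rep-idem x)) φx≡a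
    fibres : ∀ u w → keep u ≡ true → keep w ≡ true →
      (φ u ≡ φ w → Reach (CutEdge Es? X) u w) × (Reach (CutEdge Es? X) u w → φ u ≡ φ w)
    fibres u w ku kw = rep-connected u w ku kw ∘ ≡-φ , φ-≡ ∘ rep-invariant u w
    edges : ∀ a b →
      (Edge H a b → ∃ λ u → ∃ λ w → Es u w × φ u ≡ a × φ w ≡ b × a ≢ b) ×
      ((∃ λ u → ∃ λ w → Es u w × φ u ≡ a × φ w ≡ b × a ≢ b) → Edge H a b)
    edges a b = to , from
      where
      to : Edge H a b → ∃ λ u → ∃ λ w → Es u w × φ u ≡ a × φ w ≡ b × a ≢ b
      to ab with from-does (quotient-edge? a b) ab
      ... | a≢b , u , w , ru , rw , uw =
        u , w , uw , ι-injective _ _ (trans (factors u) ru) , ι-injective _ _ (trans (factors w) rw) , a≢b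
      from : (∃ λ u → ∃ λ w → Es u w × φ u ≡ a × φ w ≡ b × a ≢ b) → Edge H a b
      from (u , w , uw , refl , refl , a≢b) =
        dec-true (quotient-edge? (φ u) (φ w)) (a≢b , u , w , ≡sym (factors u) , ≡sym (factors w) , uw)

  -- H has fewer vertices: ι is injective and never hits `missed`.
  smaller : n H < n G
  smaller = injective⇒≤ (λ {i} {j} → extended-injective i j)
    where
    ι-misses : ∀ i → ι i ≢ missed
    ι-misses i e with onto-surjective i
    ... | x , refl = missed-not-rep x (trans (≡sym (factors x)) e)
    extended : Fin (suc classes) → Fin (n G)
    extended zero = missed
    extended (suc i) = ι i
    extended-injective : ∀ i j → extended i ≡ extended j → i ≡ j
    extended-injective zero zero _ = refl
    extended-injective zero (suc j) e = absurd (ι-misses j (≡sym e))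
    extended-injective (suc i) zero e = absurd (ι-misses i e)
    extended-injective (suc i) (suc j) e = cong suc (ι-injective i j e)

  extend-colouring : (v : Fin (n G)) →
    (∀ x y → Edge G x y → x ≢ v → y ≢ v → Es x y × rep x ≢ rep y) →
    ∀ {k k′} (c : Fin (n H) → Fin k) → (∀ a b → Edge H a b → c a ≢ c b) →
    (e : Fin k → Fin k′) → (∀ i j → e i ≡ e j → i ≡ j) →
    (c* : Fin k′) → (∀ y → Edge G v y → e (c (φ y)) ≢ c*) → Colorable G k′
  extend-colouring v survives {k′ = k′} c c-proper e e-injective c* c*-fresh = colour , proper
    where
    colour : Fin (n G) → Fin k′
    colour x with x ≟ v
    ... | yes _ = c*
    ... | no _ = e (c (φ x))
    proper : ∀ x y → Edge G x y → colour x ≢ colour y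
    proper x y xy with x ≟ v | y ≟ v
    ... | yes refl | yes refl = λ _ → no-loop G xy refl
    ... | yes refl | no _ = c*-fresh y xy ∘ ≡sym
    ... | no _ | yes refl = c*-fresh x (edge-sym G xy)
    ... | no x≢v | no y≢v with survives x y xy x≢v y≢v
    ...   | Es-xy , rx≢ry = c-proper _ _ (edge-transfer x y Es-xy rx≢ry) ∘ e-injective _ _

-- K − x₀: the representative of x₀ is another vertex x₁, nothing is contracted.
module Deletion (K : Graph) (x₀ x₁ : Fin (n K)) (x₀≢x₁ : x₀ ≢ x₁) where

  KeptEdge : Fin (n K) → Fin (n K) → Set
  KeptEdge u w = Edge K u w × u ≢ x₀ × w ≢ x₀

  kept-edge? : ∀ u w → Dec (KeptEdge u w)
  kept-edge? u w = (adj K u w ≟ᵇ true) ×-dec ¬? (u ≟ x₀) ×-dec ¬? (w ≟ x₀)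

  rep : Fin (n K) → Fin (n K)
  rep x with x ≟ x₀
  ... | yes _ = x₁
  ... | no _ = x

  rep-other : ∀ {x} → x ≢ x₀ → rep x ≡ x
  rep-other {x} x≢x₀ with x ≟ x₀
  ... | yes x≡x₀ = absurd (x≢x₀ x≡x₀)
  ... | no _ = refl

  rep-≢ : ∀ x → rep x ≢ x₀
  rep-≢ x with x ≟ x₀
  ... | yes _ = x₀≢x₁ ∘ ≡sym
  ... | no x≢x₀ = x≢x₀

  contraction : Contraction K
  contraction = record
    { keep = keep
    ; Es? = λ u w → does (kept-edge? u w)
    ; Es-edge = λ u w h → let (e , u≢ , w≢) = from-does (kept-edge? u w) h
                          in e , dec-true (¬? (u ≟ x₀)) u≢ , dec-true (¬? (w ≟ x₀)) w≢
    ; Es-sym = λ u w h → let (e , u≢ , w≢) = from-does (kept-edge? u w) h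
                         in dec-true (kept-edge? w u) (edge-sym K e , w≢ , u≢)
    ; X = λ _ → false
    ; rep = rep
    ; rep-kept = λ x → dec-true (¬? (rep x ≟ x₀)) (rep-≢ x)
    ; rep-idem = λ x → rep-other (rep-≢ x)
    ; rep-connected = connected
    ; rep-invariant = invariant
    ; missed = x₀
    ; missed-not-rep = rep-≢
    }
    where
    keep : Fin (n K) → Bool
    keep x = does (¬? (x ≟ x₀))
    Cut : Fin (n K) → Fin (n K) → Set
    Cut = CutEdge (λ u w → does (kept-edge? u w)) (λ _ → false)
    connected : ∀ u w → keep u ≡ true → keep w ≡ true → rep u ≡ rep w → Reach Cut u w
    connected u w ku kw ru≡rw = subst (Reach Cut u) u≡w ε
      where
      u≡w : u ≡ w
      u≡w = trans (≡sym (rep-other (from-does (¬? (u ≟ x₀)) ku)))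
                  (trans ru≡rw (rep-other (from-does (¬? (w ≟ x₀)) kw)))
    -- X is constant, so no edge is cut.
    invariant : ∀ u w → Reach Cut u w → rep u ≡ rep w
    invariant u .u ε = refl
    invariant u w ((_ , X≢) ◅ _) = absurd (X≢ refl)

  open Quotient contraction public

  survives : ∀ x y → Edge K x y → x ≢ x₀ → y ≢ x₀ → Es x y × rep x ≢ rep y
  survives x y xy x≢x₀ y≢x₀ =
    dec-true (kept-edge? x y) (xy , x≢x₀ , y≢x₀) ,
    λ rx≡ry → no-loop K xy (trans (≡sym (rep-other x≢x₀)) (trans rx≡ry (rep-other y≢x₀)))

  add-colour : ∀ {k} → Colorable H k → Colorable K (suc k)
  add-colour {k} (c , c-proper) =
    extend-colouring x₀ survives c c-proper inject₁ (λ _ _ → inject₁-injective)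
      (fromℕ k) (λ _ _ → fromℕ≢inject₁ ∘ ≡sym)

-- If K needs at least t′ + 1 colours, then some odd minor of K with at
-- most as many vertices has chromatic number exactly t′ + 1: delete
-- vertices until t′ + 1 colours suffice.  (Double negation, since
-- colourability is not decided here.)
exact-χ-minor : ∀ t′ (K : Graph) → (∀ {k} → k ≤ t′ → ¬ Colorable K k) →
  ¬ ¬ (Σ Graph λ K′ → OddMinor K K′ × n K′ ≤ n K × HasChromaticNumber K′ (suc t′))
exact-χ-minor t′ K needs = descend (suc (n K)) K ≤-refl needs
  where
  descend : ∀ s (K : Graph) → n K < s → (∀ {k} → k ≤ t′ → ¬ Colorable K k) →
    ¬ ¬ (Σ Graph λ K′ → OddMinor K K′ × n K′ ≤ n K × HasChromaticNumber K′ (suc t′))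
  descend (suc s) K (s≤s nK≤s) needs no-minor = ¬¬-excluded-middle λ where
      (yes colourable) → no-minor (K , ε , ≤-refl , colourable , least)
      (no uncolourable) → shrink (two-vertices K (uncolourable ∘ weaken {K} (s≤s z≤n))) uncolourable
    where
    least : ∀ k → Colorable K k → suc t′ ≤ k
    least k C with k ≤? t′
    ... | yes k≤t′ = absurd (needs k≤t′ C)
    ... | no k≰t′ = ≰⇒> k≰t′
    shrink : (∃₂ λ (x₀ x₁ : Fin (n K)) → x₀ ≢ x₁) → ¬ Colorable K (suc t′) → ⊥
    shrink (x₀ , x₁ , x₀≢x₁) uncolourable =
      descend s D.H (<-≤-trans D.smaller nK≤s) needs′
        λ (K′ , H⇝K′ , nK′≤nH , χ) →
          no-minor (K′ , D.step ◅ H⇝K′ , ≤-trans nK′≤nH (≤-trans (n≤1+n _) D.smaller) , χ)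
      where
      module D = Deletion K x₀ x₁ x₀≢x₁
      needs′ : ∀ {k} → k ≤ t′ → ¬ Colorable D.H k
      needs′ k≤t′ = uncolourable ∘ weaken {K} (s≤s k≤t′) ∘ D.add-colour

not-colourable : ∀ {t′ G} → MinimalCounterexample (suc t′) G → ¬ Colorable G t′
not-colourable ((_ , least) , _) C = 1+n≰n (least _ C)

irreducible : ∀ {t′ G} → MinimalCounterexample (suc t′) G → (H : Graph) → OddMinorStep G H → n H < n G →
  (∀ {k} → k ≤ t′ → Colorable H k → Colorable G t′) → ⊥
irreducible {t′} {G} mc@(_ , minimal , _) H step nH<nG lift =
  exact-χ-minor t′ H (λ k≤t′ → not-colourable mc ∘ lift k≤t′)
    λ (K , H⇝K , nK≤nH , χ) →
      minimal K ((step ◅ H⇝K) , fewer-vertices⇒¬Iso {G} {K} (<-≤-trans (s≤s nK≤nH) nH<nG)) χ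

-- A vertex of degree < t′ can be deleted: v gets a colour unused on N(v).
low-degree : ∀ {t′ G} → MinimalCounterexample (suc t′) G → ∀ v → deg G v < t′ → ⊥
low-degree {t′} {G} mc v deg<t′ with any? (λ w → ¬? (w ≟ v))
... | yes (w , w≢v) = irreducible mc D.H D.step D.smaller lift
  where
  module D = Deletion G v w (w≢v ∘ ≡sym)
  lift : ∀ {k} → k ≤ t′ → Colorable D.H k → Colorable G t′
  lift k≤t′ (c , c-proper) with free-colour (N G v) (λ y → inject≤ (c (D.φ y)) k≤t′) deg<t′
  ... | c* , fresh =
    D.extend-colouring v D.survives c c-proper (λ i → inject≤ i k≤t′) (inject≤-injective k≤t′ k≤t′)
      c* (λ y vy → fresh y (edge⇒∈N G vy))
... | no only-v = n≮0 (<-≤-trans deg<t′ (s≤s⁻¹ (proj₂ (proj₁ mc) 1 one-colour)))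
  where
  -- v is the only vertex, so one colour suffices and t′ = 0.
  one-colour : Colorable G 1
  one-colour = (λ _ → zero) , λ x y xy _ → no-loop G xy (trans (is-v x) (≡sym (is-v y)))
    where
    is-v : ∀ x → x ≡ v
    is-v x with x ≟ v
    ... | yes x≡v = x≡v
    ... | no x≢v = absurd (only-v (x , x≢v))

-- Contract the edges from v to a set N′ ⊆ N(v) (the cut δ({v})
-- after deleting the edges from v to N(v) ∖ N′): v and N′ become one vertex.
module Star (G : Graph) (v : Fin (n G)) (N′ : Subset (n G)) (N′⊆N : N′ ⊆ N G v)
            (u₀ : Fin (n G)) (u₀∈N′ : u₀ ∈ N′) where

  v∉N′ : v ∉ N′
  v∉N′ v∈N′ = no-loop G (∈N⇒edge G (N′⊆N v∈N′)) refl

  ∈N′⇒≢v : ∀ {u} → u ∈ N′ → u ≢ v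
  ∈N′⇒≢v u∈N′ refl = v∉N′ u∈N′

  KeptEdge : Fin (n G) → Fin (n G) → Set
  KeptEdge u w = Edge G u w × (u ≡ v → w ∈ N′) × (w ≡ v → u ∈ N′)

  kept-edge? : ∀ u w → Dec (KeptEdge u w)
  kept-edge? u w = (adj G u w ≟ᵇ true) ×-dec ((u ≟ v) →-dec (w ∈? N′)) ×-dec ((w ≟ v) →-dec (u ∈? N′))

  Es? : Fin (n G) → Fin (n G) → Bool
  Es? u w = does (kept-edge? u w)

  X : Fin (n G) → Bool
  X x = does (x ≟ v)

  Cut : Fin (n G) → Fin (n G) → Set
  Cut = CutEdge Es? X

  rep : Fin (n G) → Fin (n G)
  rep x with x ∈? N′
  ... | yes _ = v
  ... | no _ = x

  rep-cases : ∀ x → (x ∈ N′ × rep x ≡ v) ⊎ (x ∉ N′ × rep x ≡ x)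
  rep-cases x with x ∈? N′
  ... | yes x∈N′ = inj₁ (x∈N′ , refl)
  ... | no x∉N′ = inj₂ (x∉N′ , refl)

  rep-in : ∀ {x} → x ∈ N′ → rep x ≡ v
  rep-in {x} x∈N′ with x ∈? N′
  ... | yes _ = refl
  ... | no x∉N′ = absurd (x∉N′ x∈N′)

  rep-out : ∀ {x} → x ∉ N′ → rep x ≡ x
  rep-out {x} x∉N′ with x ∈? N′
  ... | yes x∈N′ = absurd (x∉N′ x∈N′)
  ... | no _ = refl

  spoke : ∀ {u} → u ∈ N′ → Cut u v × Cut v u
  spoke {u} u∈N′ =
    (dec-true (kept-edge? u v) (edge-sym G vu , absurd ∘ ∈N′⇒≢v u∈N′ , λ _ → u∈N′) , X-differs ∘ ≡sym) ,
    (dec-true (kept-edge? v u) (vu , (λ _ → u∈N′) , absurd ∘ ∈N′⇒≢v u∈N′) , X-differs)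
    where
    vu : Edge G v u
    vu = ∈N⇒edge G (N′⊆N u∈N′)
    X-differs : X v ≢ X u
    X-differs with v ≟ v | u ≟ v
    ... | yes _ | no _ = λ ()
    ... | no v≢v | _ = absurd (v≢v refl)
    ... | yes _ | yes u≡v = absurd (∈N′⇒≢v u∈N′ u≡v)

  -- A cut edge joins v to a vertex of N′.
  cut-preserves-rep : ∀ a b → Cut a b → rep a ≡ rep b
  cut-preserves-rep a b (ab , X≢) with from-does (kept-edge? a b) ab | a ≟ v | b ≟ v
  ... | _ | yes refl | yes refl = absurd (X≢ refl)
  ... | _ , b∈N′ , _ | yes refl | no _ = trans (rep-out v∉N′) (≡sym (rep-in (b∈N′ refl)))
  ... | _ , _ , a∈N′ | no _ | yes refl = trans (rep-in (a∈N′ refl)) (≡sym (rep-out v∉N′))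
  ... | _ | no _ | no _ = absurd (X≢ refl)

  rep-invariant : ∀ u w → Reach Cut u w → rep u ≡ rep w
  rep-invariant u .u ε = refl
  rep-invariant u w (_◅_ {j = x} ux xw) = trans (cut-preserves-rep u x ux) (rep-invariant x w xw)

  rep-connected : ∀ u w → rep u ≡ rep w → Reach Cut u w
  rep-connected u w ru≡rw with rep-cases u | rep-cases w
  ... | inj₁ (u∈N′ , _) | inj₁ (w∈N′ , _) = proj₁ (spoke u∈N′) ◅ proj₂ (spoke w∈N′) ◅ ε
  ... | inj₁ (u∈N′ , ru≡v) | inj₂ (_ , rw≡w) =
    subst (Reach Cut u) (trans (≡sym ru≡v) (trans ru≡rw rw≡w)) (proj₁ (spoke u∈N′) ◅ ε)
  ... | inj₂ (_ , ru≡u) | inj₁ (w∈N′ , rw≡v) =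
    subst (λ a → Reach Cut a w) (trans (≡sym rw≡v) (trans (≡sym ru≡rw) ru≡u)) (proj₂ (spoke w∈N′) ◅ ε)
  ... | inj₂ (_ , ru≡u) | inj₂ (_ , rw≡w) = subst (Reach Cut u) (trans (≡sym ru≡u) (trans ru≡rw rw≡w)) ε

  rep-≢u₀ : ∀ x → rep x ≢ u₀
  rep-≢u₀ x e with rep-cases x
  ... | inj₁ (_ , rx≡v) = v∉N′ (subst (_∈ N′) (trans (≡sym e) rx≡v) u₀∈N′)
  ... | inj₂ (x∉N′ , rx≡x) = x∉N′ (subst (_∈ N′) (trans (≡sym e) rx≡x) u₀∈N′)

  contraction : Contraction G
  contraction = record
    { keep = λ _ → true
    ; Es? = Es?
    ; Es-edge = λ u w h → proj₁ (from-does (kept-edge? u w) h) , refl , refl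
    ; Es-sym = λ u w h → let (e , u-v , w-v) = from-does (kept-edge? u w) h
                         in dec-true (kept-edge? w u) (edge-sym G e , w-v , u-v)
    ; X = X
    ; rep = rep
    ; rep-kept = λ _ → refl
    ; rep-idem = rep-idem
    ; rep-connected = λ u w _ _ → rep-connected u w
    ; rep-invariant = rep-invariant
    ; missed = u₀
    ; missed-not-rep = rep-≢u₀
    }
    where
    rep-idem : ∀ x → rep (rep x) ≡ rep x
    rep-idem x with rep-cases x
    ... | inj₁ (_ , rx≡v) rewrite rx≡v = rep-out v∉N′
    ... | inj₂ (_ , rx≡x) rewrite rx≡x = rx≡x

  open Quotient contraction public

  survives : Independent G N′ → ∀ x y → Edge G x y → x ≢ v → y ≢ v → Es x y × rep x ≢ rep y
  survives independent x y xy x≢v y≢v =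
    dec-true (kept-edge? x y) (xy , absurd ∘ x≢v , absurd ∘ y≢v) , different-classes
    where
    different-classes : rep x ≢ rep y
    different-classes with rep-cases x | rep-cases y
    ... | inj₁ (x∈N′ , _) | inj₁ (y∈N′ , _) = λ _ → independent x y x∈N′ y∈N′ xy
    ... | inj₁ (_ , rx≡v) | inj₂ (_ , ry≡y) = λ e → y≢v (≡sym (trans (≡sym rx≡v) (trans e ry≡y)))
    ... | inj₂ (_ , rx≡x) | inj₁ (_ , ry≡v) = λ e → x≢v (trans (≡sym rx≡x) (trans e ry≡v))
    ... | inj₂ (_ , rx≡x) | inj₂ (_ , ry≡y) = no-loop G xy ∘ λ e → trans (≡sym rx≡x) (trans e ry≡y)

-- Contracting v with an independent N′ ⊆ N(v) is a reduction when the other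
-- neighbours of v, together with one vertex u₀ ∈ N′, lie in a set A of
-- fewer than t′ vertices: the classes adjacent to v's new position are
-- those of A, so some colour among t′ is free for v.
star-contraction : ∀ {t′ G} → MinimalCounterexample (suc t′) G →
  ∀ v (N′ : Subset (n G)) → N′ ⊆ N G v → Independent G N′ → ∀ u₀ → u₀ ∈ N′ →
  (A : Subset (n G)) → ∣ A ∣ < t′ → u₀ ∈ A → (∀ y → y ∈ N G v → y ∉ N′ → y ∈ A) → ⊥
star-contraction {t′} {G} mc v N′ N′⊆N independent u₀ u₀∈N′ A ∣A∣<t′ u₀∈A covers =
  irreducible mc S.H S.step S.smaller lift
  where
  module S = Star G v N′ N′⊆N u₀ u₀∈N′
  lift : ∀ {k} → k ≤ t′ → Colorable S.H k → Colorable G t′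
  lift k≤t′ (c , c-proper) with free-colour A colour ∣A∣<t′
    where
    colour : Fin (n G) → Fin t′
    colour y = inject≤ (c (S.φ y)) k≤t′
  ... | c* , fresh =
    S.extend-colouring v (S.survives independent) c c-proper (λ i → inject≤ i k≤t′)
      (inject≤-injective k≤t′ k≤t′) c* fresh-on-N
    where
    fresh-on-N : ∀ y → Edge G v y → inject≤ (c (S.φ y)) k≤t′ ≢ c*
    fresh-on-N y vy with y ∈? N′
    ... | no y∉N′ = fresh y (covers y (edge⇒∈N G vy) y∉N′)
    ... | yes y∈N′ =
      subst (λ a → inject≤ (c a) k≤t′ ≢ c*) (S.φ-≡ (trans (S.rep-in u₀∈N′) (≡sym (S.rep-in y∈N′))))
        (fresh u₀ u₀∈A)

-- A clique on t vertices is an odd K_t-minor: single-vertex trees, all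
-- vertices of the same colour.
clique-minor : (G : Graph) {t : ℕ} (f : Fin t → Fin (n G)) →
  (∀ i j → i ≢ j → Edge G (f i) (f j)) → HasOddKMinor G t
clique-minor G {t} f clique =
  branch , (λ _ _ → false) , (λ _ → true) , (λ _ _ ()) , (λ i → f i , branch-f i) ,
  connected , (λ _ _ ()) , joined
  where
  f-injective : ∀ {i j} → f i ≡ f j → i ≡ j
  f-injective {i} {j} e with i ≟ j
  ... | yes i≡j = i≡j
  ... | no i≢j = absurd (no-loop G (clique i j i≢j) e)
  branch : Fin (n G) → Maybe (Fin t)
  branch x with any? (λ i → f i ≟ x)
  ... | yes (i , _) = just i
  ... | no _ = nothing
  branch-f : ∀ i → branch (f i) ≡ just i
  branch-f i with any? (λ j → f j ≟ f i)
  ... | yes (j , fj≡fi) = cong just (f-injective fj≡fi)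
  ... | no none = absurd (none (i , refl))
  branch-just : ∀ {x i} → branch x ≡ just i → f i ≡ x
  branch-just {x} h with any? (λ j → f j ≟ x)
  branch-just {x} refl | yes (j , fj≡x) = fj≡x
  branch-just {x} () | no _
  connected : ∀ i u w → branch u ≡ just i → branch w ≡ just i → Reach (λ _ _ → false ≡ true) u w
  connected i u w hu hw = subst (Reach _ u) (trans (≡sym (branch-just hu)) (branch-just hw)) ε
  joined : ∀ i j → i ≢ j → ∃ λ u → ∃ λ w →
    branch u ≡ just i × branch w ≡ just j × Edge G u w × true ≡ true
  joined i j i≢j = f i , f j , branch-f i , branch-f j , clique i j i≢j , refl

closed-neighbourhood : (G : Graph) (v : Fin (n G)) → Fin (suc (deg G v)) → Fin (n G)
closed-neighbourhood G v zero = v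
closed-neighbourhood G v (suc i) = members (N G v) i

closed-neighbourhood-clique : (G : Graph) (v : Fin (n G)) →
  (∀ u w → u ∈ N G v → w ∈ N G v → u ≢ w → Edge G u w) →
  ∀ i j → i ≢ j → Edge G (closed-neighbourhood G v i) (closed-neighbourhood G v j)
closed-neighbourhood-clique G v clique zero zero 0≢0 = absurd (0≢0 refl)
closed-neighbourhood-clique G v clique zero (suc j) _ = ∈N⇒edge G (members-∈ (N G v) j)
closed-neighbourhood-clique G v clique (suc i) zero _ = edge-sym G (∈N⇒edge G (members-∈ (N G v) i))
closed-neighbourhood-clique G v clique (suc i) (suc j) i≢j =
  clique _ _ (members-∈ (N G v) i) (members-∈ (N G v) j) (i≢j ∘ cong suc ∘ members-injective (N G v))

-- Degree t′ = t − 1: two non-adjacent neighbours u, w give a star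
-- contraction with A = N(v) − w; otherwise {v} ∪ N(v) is a K_t.
non-adjacent-neighbours? : (G : Graph) (v : Fin (n G)) →
  Dec (∃₂ λ u w → u ∈ N G v × w ∈ N G v × u ≢ w × ¬ Edge G u w)
non-adjacent-neighbours? G v =
  any? λ u → any? λ w → (u ∈? N G v) ×-dec (w ∈? N G v) ×-dec ¬? (u ≟ w) ×-dec ¬? (adj G u w ≟ᵇ true)

degree-t-1 : ∀ {t′ G} → MinimalCounterexample (suc t′) G → ∀ v → deg G v ≡ t′ → ⊥
degree-t-1 {t′} {G} mc v deg≡t′ with non-adjacent-neighbours? G v
... | yes (u , w , u∈N , w∈N , u≢w , u≁w) =
  star-contraction mc v pair pair⊆N pair-independent u (x∈p∪q⁺ (inj₁ (x∈⁅x⁆ u)))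
    (N G v - w) ∣N-w∣<t′ (x∈p∧x≢y⇒x∈p-y u∈N u≢w) others-in-N-w
  where
  pair : Subset (n G)
  pair = ⁅ u ⁆ ∪ ⁅ w ⁆
  ∣N-w∣<t′ : ∣ N G v - w ∣ < t′
  ∣N-w∣<t′ = subst (∣ N G v - w ∣ <_) deg≡t′ (x∈p⇒∣p-x∣<∣p∣ w∈N)
  others-in-N-w : ∀ y → y ∈ N G v → y ∉ pair → y ∈ N G v - w
  others-in-N-w y y∈N y∉pair = x∈p∧x≢y⇒x∈p-y y∈N λ where refl → y∉pair (x∈p∪q⁺ (inj₂ (x∈⁅x⁆ w)))
  in-pair : ∀ {a} → a ∈ pair → a ≡ u ⊎ a ≡ w
  in-pair {a} h with x∈p∪q⁻ ⁅ u ⁆ ⁅ w ⁆ h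
  ... | inj₁ a∈u = inj₁ (x∈⁅y⁆⇒x≡y u a∈u)
  ... | inj₂ a∈w = inj₂ (x∈⁅y⁆⇒x≡y w a∈w)
  pair⊆N : pair ⊆ N G v
  pair⊆N h with in-pair h
  ... | inj₁ refl = u∈N
  ... | inj₂ refl = w∈N
  pair-independent : Independent G pair
  pair-independent a c ha hc ac with in-pair ha | in-pair hc
  ... | inj₁ refl | inj₁ refl = no-loop G ac refl
  ... | inj₁ refl | inj₂ refl = u≁w ac
  ... | inj₂ refl | inj₁ refl = u≁w (edge-sym G ac)
  ... | inj₂ refl | inj₂ refl = no-loop G ac refl
... | no no-pair = proj₂ (proj₂ mc)
  (subst (HasOddKMinor G ∘ suc) deg≡t′
    (clique-minor G (closed-neighbourhood G v) (closed-neighbourhood-clique G v clique)))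
  where
  clique : ∀ u w → u ∈ N G v → w ∈ N G v → u ≢ w → Edge G u w
  clique u w u∈N w∈N u≢w with adj G u w ≟ᵇ true
  ... | yes uw = uw
  ... | no u≁w = absurd (no-pair (u , w , u∈N , w∈N , u≢w , u≁w))

minimum-degree : ∀ {t′ G} → MinimalCounterexample (suc t′) G → ∀ v → suc t′ ≤ deg G v
minimum-degree {t′} {G} mc v with suc t′ ≤? deg G v
... | yes t≤deg = t≤deg
... | no t≰deg with m≤n⇒m<n∨m≡n (s≤s⁻¹ (≰⇒> t≰deg))
...   | inj₁ deg<t′ = absurd (low-degree mc v deg<t′)
...   | inj₂ deg≡t′ = absurd (degree-t-1 mc v deg≡t′)

-- Counting for the second claim: with N′ ⊆ N(v), the set
-- A = (N(v) ∖ N′) ∪ {u₀} has at most deg v − ∣ N′ ∣ + 1 < t′ elements.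
star-set-bound : ∀ {m t′ l} (Nv N′ : Subset m) (u₀ : Fin m) → N′ ⊆ Nv →
  ∣ Nv ∣ + 2 ≡ suc t′ + l → l + 1 ≤ ∣ N′ ∣ → ∣ (Nv ─ N′) ∪ ⁅ u₀ ⁆ ∣ < t′
star-set-bound {t′ = t′} {l} Nv N′ u₀ N′⊆Nv size l+1≤∣N′∣ = +-cancelʳ-≤ (l + 1) (suc ∣ A ∣) t′ chain
  where
  open ≤-Reasoning
  A : Subset _
  A = (Nv ─ N′) ∪ ⁅ u₀ ⁆
  D : ℕ
  D = ∣ Nv ─ N′ ∣
  ∣A∣≤D+1 : ∣ A ∣ ≤ D + 1
  ∣A∣≤D+1 = subst (λ s → ∣ A ∣ ≤ D + s) (∣⁅x⁆∣≡1 u₀) (∣p∪q∣≤∣p∣+∣q∣ (Nv ─ N′) ⁅ u₀ ⁆)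
  ∣N′∣≤∣Nv∩N′∣ : ∣ N′ ∣ ≤ ∣ Nv ∩ N′ ∣
  ∣N′∣≤∣Nv∩N′∣ = p⊆q⇒∣p∣≤∣q∣ (λ x∈N′ → x∈p∩q⁺ (N′⊆Nv x∈N′ , x∈N′))
  chain : suc ∣ A ∣ + (l + 1) ≤ t′ + (l + 1)
  chain = begin
    suc ∣ A ∣ + (l + 1)       ≤⟨ +-mono-≤ (s≤s ∣A∣≤D+1) (≤-trans l+1≤∣N′∣ ∣N′∣≤∣Nv∩N′∣) ⟩
    suc (D + 1) + ∣ Nv ∩ N′ ∣ ≡⟨ regroup D ∣ Nv ∩ N′ ∣ ⟩
    (D + ∣ Nv ∩ N′ ∣) + 2     ≡⟨ cong (_+ 2) (∣p─q∣+∣p∩q∣≡∣p∣ Nv N′) ⟩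
    ∣ Nv ∣ + 2                ≡⟨ size ⟩
    suc t′ + l                ≡⟨ shift t′ l ⟩
    t′ + (l + 1)              ∎
    where
    regroup : ∀ d s → suc (d + 1) + s ≡ (d + s) + 2
    regroup = solve-∀
    shift : ∀ a b → suc a + b ≡ a + (b + 1)
    shift = solve-∀

-- Second claim: contract v with N′; an empty N′ is too small anyway.
no-large-independent-set : ∀ {t′ G} → MinimalCounterexample (suc t′) G →
  ∀ v l → deg G v + 2 ≡ suc t′ + l →
  ¬ (Σ (Subset (n G)) λ N′ → N′ ⊆ N G v × Independent G N′ × l + 1 ≤ ∣ N′ ∣)
no-large-independent-set {t′} {G} mc v l size (N′ , N′⊆N , independent , l+1≤∣N′∣) with nonempty? N′
... | yes (u₀ , u₀∈N′) =
  star-contraction mc v N′ N′⊆N independent u₀ u₀∈N′ ((N G v ─ N′) ∪ ⁅ u₀ ⁆)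
    (star-set-bound (N G v) N′ u₀ N′⊆N size l+1≤∣N′∣) (x∈p∪q⁺ (inj₂ (x∈⁅x⁆ u₀)))
    (λ y y∈N y∉N′ → x∈p∪q⁺ (inj₁ (x∈p∧x∉q⇒x∈p─q y∈N y∉N′)))
... | no empty = n≮0 (subst (_ ≤_) (trans (cong ∣_∣ (Empty-unique empty)) (∣⊥∣≡0 (n G)))
                              (≤-trans (m≤n+m 1 l) l+1≤∣N′∣))

lemma7p4 : (t : ℕ) (G : Graph) → MinimalCounterexample t G →
    ((v : Fin (n G)) → t ≤ deg G v) ×
    ((v : Fin (n G)) (l : ℕ) → deg G v + 2 ≡ t + l →
      ¬ (Σ (Subset (n G)) λ N′ → N′ ⊆ N G v × Independent G N′ × l + 1 ≤ ∣ N′ ∣))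
lemma7p4 zero G (((colouring , _) , _) , _) = (λ v → absurd (no-colour v)) , (λ v → absurd (no-colour v))
  where
  -- χ(G) = 0 means G has no vertices.
  no-colour : Fin (n G) → ⊥
  no-colour v with colouring v
  ... | ()
lemma7p4 (suc t′) G mc = minimum-degree mc , no-large-independent-set mc
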